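{- Let $G$ be a graph whose node set is discrete. For all $x,y,z:\mathsf{N}_G$ and $w:\mathsf{W}_G(x,y)$, the type $z\in w$ is a finite set.
   Context: Setting: homotopy type theory. $\mathsf{isFinite}(X):\equiv\sum_{n:\mathbb{N}}\|X\simeq⟦n⟧\|$ with $⟦n⟧$ the $n$-element type. A graph $G$: a set $\mathsf{N}_G$ of nodes (discrete = decidable equality) and sets $\mathsf{E}_G(x,y)$ of edges. Walks: inductive family $\mathsf{W}_G(x,y)$ with $\langle x\rangle:\mathsf{W}_G(x,x)$ and $e\odot w:\mathsf{W}_G(x,z)$ for $e:\mathsf{E}_G(x,y)$, $w:\mathsf{W}_G(y,z)$. For a node $z$: $z\in\langle u\rangle:\equiv\mathbb{0}$, $z\in(e\odot w):\equiv(z=\mathsf{source}(e))+(z\in w)$. -}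

module Defs where

open import Level using (Level; _⊔_; suc; Lift)
open import Data.Nat using (ℕ)
open import Data.Fin using (Fin)
open import Data.Product using (Σ; _×_)
open import Data.Sum using (_⊎_)
open import Data.Empty.Polymorphic using (⊥)
open import Relation.Binary.PropositionalEquality using (_≡_)
open import Relation.Binary.Definitions using (DecidableEquality)
open import Function.Bundles using (_↔_)

private variable ℓ ℓ₁ ℓ₂ : Level

isProp : Set ℓ → Set ℓ
isProp A = (a b : A) → a ≡ b

isSet : Set ℓ → Set ℓ
isSet A = (a b : A) → isProp (a ≡ b)

-- propositional truncation, impredicative encoding (no HITs available)
∥_∥ : Set ℓ → Set (suc ℓ)
∥_∥ {ℓ} A = (P : Set ℓ) → isProp P → (A → P) → P

-- the n-element type ⟦n⟧ is Fin n; X ≃ ⟦n⟧ rendered as a (quasi-)inverse pair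
isFinite : Set ℓ → Set (suc ℓ)
isFinite X = Σ ℕ (λ n → ∥ X ↔ Fin n ∥)

record Graph (ℓ₁ ℓ₂ : Level) : Set (suc (ℓ₁ ⊔ ℓ₂)) where
  field
    N     : Set ℓ₁
    E     : N → N → Set ℓ₂
    N-set : isSet N
    E-set : (x y : N) → isSet (E x y)

open Graph public

data W (G : Graph ℓ₁ ℓ₂) : N G → N G → Set (ℓ₁ ⊔ ℓ₂) where
  ⟨_⟩  : (x : N G) → W G x x
  _⊙_ : {x y z : N G} → E G x y → W G y z → W G x z

_∈_ : {G : Graph ℓ₁ ℓ₂} {x y : N G} → N G → W G x y → Set ℓ₁
_∈_ z ⟨ u ⟩ = ⊥
_∈_ z (_⊙_ {x = x} e w) = (z ≡ x) ⊎ (z ∈ w)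

isDiscrete : Set ℓ → Set ℓ
isDiscrete A = DecidableEquality A

-- Membership in a walk is a sum, over the edges of the walk, of the
-- propositions z ≡ source e.  Each summand is a decidable proposition (the node
-- type is a discrete set), hence in bijection with Fin 0 or Fin 1, and sums of
-- types in bijection with some Fin n are again so.  A type in bijection with
-- Fin n inherits decidable equality, so it is a set by Hedberg's theorem.
module Submission where

open import Defs
open import Level using (Level)
open import Data.Nat using (ℕ; _+_)
open import Data.Fin using (Fin; zero; suc)
open import Data.Fin.Properties using (+↔⊎) renaming (_≟_ to _≟ᶠ_)
open import Data.Product using (Σ; _×_; _,_)
open import Data.Sum using (_⊎_)
open import Data.Sum.Function.Propositional using (_⊎-↔_)
open import Data.Empty.Polymorphic using (⊥)
open import Relation.Nullary using (Dec; yes; no; contradiction)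
open import Relation.Nullary.Decidable using (via-injection)
open import Relation.Binary.PropositionalEquality using (refl)
open import Function.Bundles using (_↔_; mk↔ₛ′)
open import Function.Properties.Inverse using (↔-sym; ↔-trans; Inverse⇒Injection)
open import Axiom.UniquenessOfIdentityProofs using (module Decidable⇒UIP)

private variable
  a b ℓ₁ ℓ₂ : Level
  A : Set a
  B : Set b

-- isFinite without the truncation: the bijection is kept so the induction can extend it.
Enumerated : Set a → Set a
Enumerated A = Σ ℕ λ n → A ↔ Fin n

⊥-enumerated : Enumerated (⊥ {a})
⊥-enumerated = 0 , mk↔ₛ′ (λ ()) (λ ()) (λ ()) (λ ())

isProp∧Dec⇒enumerated : isProp A → Dec A → Enumerated A
isProp∧Dec⇒enumerated A-prop (yes a) =
  1 , mk↔ₛ′ (λ _ → zero) (λ _ → a) (λ { zero → refl ; (suc ()) }) (A-prop a)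
isProp∧Dec⇒enumerated A-prop (no ¬a) =
  0 , mk↔ₛ′ (λ a → contradiction a ¬a) (λ ()) (λ ()) (λ a → contradiction a ¬a)

⊎-enumerated : Enumerated A → Enumerated B → Enumerated (A ⊎ B)
⊎-enumerated (m , A↔m) (n , B↔n) = m + n , ↔-trans (A↔m ⊎-↔ B↔n) (↔-sym +↔⊎)

enumerated⇒isSet : Enumerated A → isSet A
enumerated⇒isSet (n , A↔n) _ _ = ≡-irrelevant
  where open Decidable⇒UIP (via-injection (Inverse⇒Injection A↔n) _≟ᶠ_)

enumerated⇒isFinite : Enumerated A → isFinite A
enumerated⇒isFinite (n , A↔n) = n , λ _ _ k → k A↔n

∈-enumerated : (G : Graph ℓ₁ ℓ₂) → isDiscrete (N G) →
  {x y : N G} (z : N G) (w : W G x y) → Enumerated (z ∈ w)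
∈-enumerated G _≟_ z ⟨ _ ⟩ = ⊥-enumerated
∈-enumerated G _≟_ z (_⊙_ {x = x} e w) =
  ⊎-enumerated (isProp∧Dec⇒enumerated (N-set G z x) (z ≟ x)) (∈-enumerated G _≟_ z w)

lemma4p16 : {ℓ₁ ℓ₂ : Level} (G : Graph ℓ₁ ℓ₂) → isDiscrete (N G) →
    (x y z : N G) (w : W G x y) → isSet (z ∈ w) × isFinite (z ∈ w)
lemma4p16 G discrete x y z w =
  enumerated⇒isSet z∈w-enumerated , enumerated⇒isFinite z∈w-enumerated
  where
  z∈w-enumerated : Enumerated (z ∈ w)
  z∈w-enumerated = ∈-enumerated G discrete z w
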